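{- Let $A\subseteq\mathrm{Ag}$, let $x\in\{D,T,B,4,5\}$, and let $\mathsf{L}_1,\mathsf{L}_2$ be logics without fixed-point operators such that $\mathsf{L}_1(\alpha)=\mathsf{L}_2(\alpha)\cup\{x\}$ for $\alpha\in A$ and $\mathsf{L}_1(\alpha)=\mathsf{L}_2(\alpha)$ otherwise. Assume that, for each agent $\alpha$, $\mathsf{L}_2(\alpha)$ only includes frame conditions that precede $x$ in the order $D,T,B,4,5$. Then for every formula $\varphi$ (without fixed-point operators), $\varphi$ is $\mathsf{L}_1$-satisfiable if and only if $\mathrm{tr}^x_A(\varphi)$ is $\mathsf{L}_2$-satisfiable, where $$\mathrm{tr}^x_A(\varphi)=\varphi\wedge\mathsf{Inv}_d\Big(\bigwedge_{\psi\in\overline{\mathsf{sub}}(\varphi),\ \alpha\in A}\mathsf{ax}^x_\alpha[\psi/p]\Big),$$ with $d=md(\varphi)$ if $x\notin\{4,5\}$ and $d=md(\varphi)\cdot|\varphi|$ if $x\in\{4,5\}$.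
   Context: Fix a finite set $\mathrm{Ag}$ of agents and finitely many propositional variables. Formulas (without fixed points): $\varphi ::= p \mid \neg p \mid \mathtt{tt} \mid \mathtt{ff} \mid \varphi\wedge\varphi \mid \varphi\vee\varphi \mid \langle\alpha\rangle\varphi \mid [\alpha]\varphi$, interpreted on Kripke models $(W,R,V)$ with $R\subseteq W\times\mathrm{Ag}\times W$ (agent relations $R_\alpha$) in the standard way. Negation $\neg\psi$ of an arbitrary formula is defined by pushing negation inwards via De Morgan and modal dualities, and $\psi\to\chi$ abbreviates $\neg\psi\vee\chi$. Frame conditions on $R_\alpha$: $D$ serial, $T$ reflexive, $B$ symmetric, $4$ transitive, $5$ euclidean. A logic $\mathsf{L}$ assigns to each agent $\alpha$ a set $\mathsf{L}(\alpha)$ of conditions; $\mathsf{L}$-models are Kripke models where each $R_\alpha$ satisfies $\mathsf{L}(\alpha)$; $\varphi$ is $\mathsf{L}$-satisfiable if true at some state of some $\mathsf{L}$-model. $\mathsf{sub}(\varphi)$ is the set of subformulas of $\varphi$, $|\varphi|=|\mathsf{sub}(\varphi)|$, and $\overline{\mathsf{sub}}(\varphi)=\mathsf{sub}(\varphi)\cup\{\neg\psi\mid\psi\in\mathsf{sub}(\varphi)\}$. Modal depth: $md$ is $0$ on $p,\neg p,\mathtt{tt},\mathtt{ff}$, $md(\psi\wedge\chi)=md(\psi\vee\chi)=\max(md(\psi),md(\chi))$, $md([\alpha]\psi)=md(\langle\alpha\rangle\psi)=1+md(\psi)$. $[\mathrm{Ag}]\chi=\bigwedge_{\alpha\in\mathrm{Ag}}[\alpha]\chi$,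 $[\mathrm{Ag}]^0\chi=\chi$, $[\mathrm{Ag}]^{i+1}\chi=[\mathrm{Ag}][\mathrm{Ag}]^i\chi$, and $\mathsf{Inv}_d(\chi)=\bigwedge_{i\le d}[\mathrm{Ag}]^i\chi$. Axioms (with $p$ a placeholder variable, $[\psi/p]$ substitution): $\mathsf{ax}^D_\alpha=\langle\alpha\rangle\mathtt{tt}$; $\mathsf{ax}^T_\alpha=[\alpha]p\to p$; $\mathsf{ax}^B_\alpha=\langle\alpha\rangle[\alpha]p\to p$; $\mathsf{ax}^4_\alpha=[\alpha]p\to[\alpha][\alpha]p$; $\mathsf{ax}^5_\alpha=\langle\alpha\rangle[\alpha]p\to[\alpha]p$. -}

module Defs where

open import Data.Nat using (ℕ; zero; suc; _*_; _⊔_)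
open import Data.Fin using (Fin)
open import Data.Fin.Subset using (Subset; _∈_; _∉_)
open import Data.Fin.Subset.Properties using (_∈?_)
open import Data.Fin.Properties using () renaming (_≟_ to _≟Fin_)
open import Data.Bool using (Bool; true; false; _∧_; if_then_else_)
open import Data.List using (List; []; _∷_; _++_; map; length; filter; foldr; allFin; concatMap; deduplicateᵇ)
open import Data.Product using (Σ; _×_; _,_)
open import Data.Sum using (_⊎_)
open import Data.Unit using (⊤)
open import Data.Empty using (⊥)
open import Relation.Nullary using (¬_; does)
open import Relation.Binary.PropositionalEquality using (_≡_)

data Form (n m : ℕ) : Set where
  var  : Fin m → Form n m
  nvar : Fin m → Form n m
  tt   : Form n m
  ff   : Form n m
  _∧F_ : Form n m → Form n m → Form n m
  _∨F_ : Form n m → Form n m → Form n m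
  ⟨_⟩_ : Fin n → Form n m → Form n m
  [_]_ : Fin n → Form n m → Form n m

infixr 6 _∧F_
infixr 5 _∨F_

module _ {n m : ℕ} where

  neg : Form n m → Form n m
  neg (var p)  = nvar p
  neg (nvar p) = var p
  neg tt       = ff
  neg ff       = tt
  neg (a ∧F b) = neg a ∨F neg b
  neg (a ∨F b) = neg a ∧F neg b
  neg (⟨ α ⟩ a) = [ α ] neg a
  neg ([ α ] a) = ⟨ α ⟩ neg a

  _⇒F_ : Form n m → Form n m → Form n m
  a ⇒F b = neg a ∨F b

  eqF : Form n m → Form n m → Bool
  eqF (var p)   (var q)   = does (p ≟Fin q)
  eqF (nvar p)  (nvar q)  = does (p ≟Fin q)
  eqF tt        tt        = true
  eqF ff        ff        = true
  eqF (a ∧F b)  (c ∧F d)  = eqF a c ∧ eqF b d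
  eqF (a ∨F b)  (c ∨F d)  = eqF a c ∧ eqF b d
  eqF (⟨ α ⟩ a) (⟨ β ⟩ b) = does (α ≟Fin β) ∧ eqF a b
  eqF ([ α ] a) ([ β ] b) = does (α ≟Fin β) ∧ eqF a b
  eqF _         _         = false

  sub : Form n m → List (Form n m)
  sub (a ∧F b)    = (a ∧F b) ∷ sub a ++ sub b
  sub (a ∨F b)    = (a ∨F b) ∷ sub a ++ sub b
  sub (⟨ α ⟩ a)   = (⟨ α ⟩ a) ∷ sub a
  sub ([ α ] a)   = ([ α ] a) ∷ sub a
  sub φ           = φ ∷ []

  size : Form n m → ℕ
  size φ = length (deduplicateᵇ eqF (sub φ))

  subbar : Form n m → List (Form n m)
  subbar φ = sub φ ++ map neg (sub φ)

  md : Form n m → ℕ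
  md (a ∧F b)  = md a ⊔ md b
  md (a ∨F b)  = md a ⊔ md b
  md (⟨ α ⟩ a) = suc (md a)
  md ([ α ] a) = suc (md a)
  md _         = 0

  ⋀ : List (Form n m) → Form n m
  ⋀ []       = tt
  ⋀ (a ∷ as) = a ∧F ⋀ as

  boxAg : Form n m → Form n m
  boxAg χ = ⋀ (map (λ α → [ α ] χ) (allFin n))

  boxAg^ : ℕ → Form n m → Form n m
  boxAg^ zero    χ = χ
  boxAg^ (suc i) χ = boxAg (boxAg^ i χ)

  Inv : ℕ → Form n m → Form n m
  Inv zero    χ = χ
  Inv (suc d) χ = Inv d χ ∧F boxAg^ (suc d) χ

data Cond : Set where
  D T B C4 C5 : Cond

rank : Cond → ℕ
rank D  = 0
rank T  = 1
rank B  = 2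
rank C4 = 3
rank C5 = 4

_≺_ : Cond → Cond → Set
c ≺ x = suc (rank c) Data.Nat.≤ rank x

Logic : ℕ → Set
Logic n = Fin n → Cond → Bool

-- axiom instances ax^x_α[ψ/p] (substitution carried out)
ax : {n m : ℕ} → Cond → Fin n → Form n m → Form n m
ax D  α ψ = ⟨ α ⟩ tt
ax T  α ψ = ([ α ] ψ) ⇒F ψ
ax B  α ψ = (⟨ α ⟩ [ α ] ψ) ⇒F ψ
ax C4 α ψ = ([ α ] ψ) ⇒F ([ α ] [ α ] ψ)
ax C5 α ψ = (⟨ α ⟩ [ α ] ψ) ⇒F ([ α ] ψ)

is45 : Cond → Bool
is45 C4 = true
is45 C5 = true
is45 _  = false

tr : {n m : ℕ} → Cond → Subset n → Form n m → Form n m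
tr {n} x A φ =
  φ ∧F Inv d (⋀ (concatMap (λ ψ → map (λ α → ax x α ψ) agentsA) (subbar φ)))
  where
    agentsA : List (Fin n)
    agentsA = filter (_∈? A) (allFin n)
    d : ℕ
    d = if is45 x then md φ * size φ else md φ

record Model (n m : ℕ) : Set₁ where
  field
    W : Set
    R : W → Fin n → W → Set
    V : W → Fin m → Set

open Model public

_,_⊨_ : {n m : ℕ} (M : Model n m) → W M → Form n m → Set
M , w ⊨ var p   = V M w p
M , w ⊨ nvar p  = ¬ V M w p
M , w ⊨ tt      = ⊤
M , w ⊨ ff      = ⊥
M , w ⊨ (a ∧F b) = (M , w ⊨ a) × (M , w ⊨ b)
M , w ⊨ (a ∨F b) = (M , w ⊨ a) ⊎ (M , w ⊨ b)
M , w ⊨ (⟨ α ⟩ a) = Σ (W M) λ v → R M w α v × (M , v ⊨ a)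
M , w ⊨ ([ α ] a) = (v : W M) → R M w α v → M , v ⊨ a

Holds : {n m : ℕ} (M : Model n m) → Fin n → Cond → Set
Holds M α D  = ∀ w → Σ (W M) λ v → R M w α v
Holds M α T  = ∀ w → R M w α w
Holds M α B  = ∀ w v → R M w α v → R M v α w
Holds M α C4 = ∀ w v u → R M w α v → R M v α u → R M w α u
Holds M α C5 = ∀ w v u → R M w α v → R M w α u → R M v α u

IsLModel : {n m : ℕ} → Logic n → Model n m → Set
IsLModel L M = ∀ α c → L α c ≡ true → Holds M α c

Satisfiable : {n m : ℕ} → Logic n → Form n m → Set₁
Satisfiable {n} {m} L φ = Σ (Model n m) λ M → IsLModel L M × Σ (W M) λ w → M , w ⊨ φ

module Submission where

-- An L₁-model validates every instance of ax^x for the agents of A, so tr(φ) holds wherever φ does.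
-- Conversely, unravel an L₂-model of tr(φ) into the tree of paths from the satisfying world: the
-- axiom instances over sub‾(φ) hold on every node of depth ≤ d. Each agent then gets a new relation
-- on the tree satisfying its L₁-conditions: local edges (child, loop, parent) when 4 and 5 are
-- absent; for 5 on A, clusters made of a node with its children and grandchildren; for 4 without 5,
-- clusters along γ-chains that keep gaining boxes, whose length stays below |φ| because the
-- number of failing boxes of φ strictly drops. The axiom instances make every box and diamond of φ
-- carry over inside such a cluster, at a height cost of 1 (resp. |φ|) per modal step, so φ is
-- still true at the root when d = md(φ) (resp. md(φ)·|φ|).

open import Defs
open import Axiom.ExcludedMiddle using (ExcludedMiddle)
open import Data.Bool using (true; false; _∧_; if_then_else_) renaming (T to IsTrue)
open import Data.Bool.Properties using (T-∧)
open import Data.Empty using (⊥; ⊥-elim)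
open import Data.Fin using (Fin; _≟_)
open import Data.Fin.Subset using (Subset; _∈_; _∉_)
open import Data.Fin.Subset.Properties using (_∈?_)
open import Data.List using (List; []; _∷_; _++_; map; length; filter; allFin; concatMap; deduplicateᵇ)
open import Data.List.Membership.Propositional using () renaming (_∈_ to _∈ˡ_)
open import Data.List.Membership.Propositional.Properties
  using (∈-++⁺ˡ; ∈-++⁺ʳ; ∈-++⁻; ∈-map⁺; ∈-map⁻; ∈-allFin; ∈-filter⁺; ∈-filter⁻)
open import Data.List.Membership.Propositional.Properties using (∈-concatMap⁺; ∈-concatMap⁻; ∈-deduplicate⁻)
open import Data.List.Relation.Unary.Any using (Any; here; there)
open import Data.List.Relation.Unary.Any.Properties using (deduplicate⁺)
open import Data.Nat using (ℕ; zero; suc; _+_; _*_; _≤_; _<_; _⊔_; z≤n; s≤s)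
open import Data.Nat.Properties hiding (_≟_)
open import Data.Product using (Σ; ∃; _×_; _,_; proj₁; proj₂)
open import Data.Sum using (_⊎_; inj₁; inj₂; map₂) renaming (map to map⊎)
open import Data.Unit using (⊤)
open import Function using (_∘_; _∘₂_; case_of_)
open import Function.Bundles using (_⇔_; mk⇔; Equivalence)
open import Level using (0ℓ)
open import Relation.Nullary using (¬_; Dec; yes; no; does)
open import Relation.Nullary.Decidable using (T?; ¬?)
open import Relation.Binary.PropositionalEquality using (_≡_; refl; sym; trans; cong; cong₂; subst)

module _ {n m : ℕ} where

  neg-involutive : (a : Form n m) → neg (neg a) ≡ a
  neg-involutive (var p)   = refl
  neg-involutive (nvar p)  = refl
  neg-involutive tt        = refl
  neg-involutive ff        = refl
  neg-involutive (a ∧F b)  = cong₂ _∧F_ (neg-involutive a) (neg-involutive b)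
  neg-involutive (a ∨F b)  = cong₂ _∨F_ (neg-involutive a) (neg-involutive b)
  neg-involutive (⟨ α ⟩ a) = cong (⟨ α ⟩_) (neg-involutive a)
  neg-involutive ([ α ] a) = cong ([ α ]_) (neg-involutive a)

  ∈-sub-self : (a : Form n m) → a ∈ˡ sub a
  ∈-sub-self (var p)   = here refl
  ∈-sub-self (nvar p)  = here refl
  ∈-sub-self tt        = here refl
  ∈-sub-self ff        = here refl
  ∈-sub-self (a ∧F b)  = here refl
  ∈-sub-self (a ∨F b)  = here refl
  ∈-sub-self (⟨ α ⟩ a) = here refl
  ∈-sub-self ([ α ] a) = here refl

  ∈-sub-trans : (φ : Form n m) {a b : Form n m} → a ∈ˡ sub φ → b ∈ˡ sub a → b ∈ˡ sub φ
  ∈-sub-trans (var p)   (here refl) q = q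
  ∈-sub-trans (nvar p)  (here refl) q = q
  ∈-sub-trans tt        (here refl) q = q
  ∈-sub-trans ff        (here refl) q = q
  ∈-sub-trans (a ∧F b)  (here refl) q = q
  ∈-sub-trans (a ∨F b)  (here refl) q = q
  ∈-sub-trans (⟨ α ⟩ a) (here refl) q = q
  ∈-sub-trans ([ α ] a) (here refl) q = q
  ∈-sub-trans (a ∧F b) (there h) q with ∈-++⁻ (sub a) h
  ... | inj₁ h′ = there (∈-++⁺ˡ (∈-sub-trans a h′ q))
  ... | inj₂ h′ = there (∈-++⁺ʳ (sub a) (∈-sub-trans b h′ q))
  ∈-sub-trans (a ∨F b) (there h) q with ∈-++⁻ (sub a) h
  ... | inj₁ h′ = there (∈-++⁺ˡ (∈-sub-trans a h′ q))
  ... | inj₂ h′ = there (∈-++⁺ʳ (sub a) (∈-sub-trans b h′ q))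
  ∈-sub-trans (⟨ α ⟩ a) (there h) q = there (∈-sub-trans a h q)
  ∈-sub-trans ([ α ] a) (there h) q = there (∈-sub-trans a h q)

  -- membership in sub‾(φ), stated so that closure under neg is immediate
  _∈cl_ : Form n m → Form n m → Set
  ψ ∈cl φ = ψ ∈ˡ sub φ ⊎ neg ψ ∈ˡ sub φ

  infix 4 _∈cl_

  module _ {φ : Form n m} where

    private
      ∧-subˡ : ∀ {a b} → (a ∧F b) ∈ˡ sub φ → a ∈ˡ sub φ
      ∧-subˡ {a} h = ∈-sub-trans φ h (there (∈-++⁺ˡ (∈-sub-self a)))
      ∧-subʳ : ∀ {a b} → (a ∧F b) ∈ˡ sub φ → b ∈ˡ sub φ
      ∧-subʳ {a} {b} h = ∈-sub-trans φ h (there (∈-++⁺ʳ (sub a) (∈-sub-self b)))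
      ∨-subˡ : ∀ {a b} → (a ∨F b) ∈ˡ sub φ → a ∈ˡ sub φ
      ∨-subˡ {a} h = ∈-sub-trans φ h (there (∈-++⁺ˡ (∈-sub-self a)))
      ∨-subʳ : ∀ {a b} → (a ∨F b) ∈ˡ sub φ → b ∈ˡ sub φ
      ∨-subʳ {a} {b} h = ∈-sub-trans φ h (there (∈-++⁺ʳ (sub a) (∈-sub-self b)))
      ◇-sub : ∀ {α a} → (⟨ α ⟩ a) ∈ˡ sub φ → a ∈ˡ sub φ
      ◇-sub {a = a} h = ∈-sub-trans φ h (there (∈-sub-self a))
      □-sub : ∀ {α a} → ([ α ] a) ∈ˡ sub φ → a ∈ˡ sub φ
      □-sub {a = a} h = ∈-sub-trans φ h (there (∈-sub-self a))

    ∈cl-∧ˡ : ∀ {a b} → a ∧F b ∈cl φ → a ∈cl φ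
    ∈cl-∧ˡ = map⊎ ∧-subˡ ∨-subˡ
    ∈cl-∧ʳ : ∀ {a b} → a ∧F b ∈cl φ → b ∈cl φ
    ∈cl-∧ʳ = map⊎ ∧-subʳ ∨-subʳ
    ∈cl-∨ˡ : ∀ {a b} → a ∨F b ∈cl φ → a ∈cl φ
    ∈cl-∨ˡ = map⊎ ∨-subˡ ∧-subˡ
    ∈cl-∨ʳ : ∀ {a b} → a ∨F b ∈cl φ → b ∈cl φ
    ∈cl-∨ʳ = map⊎ ∨-subʳ ∧-subʳ
    ∈cl-◇ : ∀ {α a} → ⟨ α ⟩ a ∈cl φ → a ∈cl φ
    ∈cl-◇ = map⊎ ◇-sub □-sub
    ∈cl-□ : ∀ {α a} → [ α ] a ∈cl φ → a ∈cl φ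
    ∈cl-□ = map⊎ □-sub ◇-sub

    ∈cl-self : φ ∈cl φ
    ∈cl-self = inj₁ (∈-sub-self φ)

    ∈cl-neg : ∀ {a} → a ∈cl φ → neg a ∈cl φ
    ∈cl-neg {a} (inj₁ h) = inj₂ (subst (_∈ˡ sub φ) (sym (neg-involutive a)) h)
    ∈cl-neg     (inj₂ h) = inj₁ h

    ∈cl⇒∈subbar : ∀ {a} → a ∈cl φ → a ∈ˡ subbar φ
    ∈cl⇒∈subbar (inj₁ h) = ∈-++⁺ˡ h
    ∈cl⇒∈subbar {a} (inj₂ h) =
      ∈-++⁺ʳ (sub φ) (subst (_∈ˡ map neg (sub φ)) (neg-involutive a) (∈-map⁺ neg h))

  private
    ∧-split : ∀ {x y} → IsTrue (x ∧ y) → IsTrue x × IsTrue y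
    ∧-split = Equivalence.to T-∧

    ≟-sound : ∀ {k} {p q : Fin k} → IsTrue (does (p ≟ q)) → p ≡ q
    ≟-sound {p = p} {q} e with p ≟ q
    ... | yes p≡q = p≡q

  eqF-sound : (a b : Form n m) → IsTrue (eqF a b) → a ≡ b
  eqF-sound (var p)   (var q)   e = cong var (≟-sound e)
  eqF-sound (nvar p)  (nvar q)  e = cong nvar (≟-sound e)
  eqF-sound tt        tt        e = refl
  eqF-sound ff        ff        e = refl
  eqF-sound (a ∧F b)  (c ∧F d)  e = cong₂ _∧F_ (eqF-sound a c (proj₁ (∧-split e))) (eqF-sound b d (proj₂ (∧-split e)))
  eqF-sound (a ∨F b)  (c ∨F d)  e = cong₂ _∨F_ (eqF-sound a c (proj₁ (∧-split e))) (eqF-sound b d (proj₂ (∧-split e)))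
  eqF-sound (⟨ α ⟩ a) (⟨ β ⟩ b) e = cong₂ ⟨_⟩_ (≟-sound (proj₁ (∧-split e))) (eqF-sound a b (proj₂ (∧-split e)))
  eqF-sound ([ α ] a) ([ β ] b) e = cong₂ [_]_ (≟-sound (proj₁ (∧-split e))) (eqF-sound a b (proj₂ (∧-split e)))

  ∈-dedup⁺ : ∀ {xs} {a : Form n m} → a ∈ˡ xs → a ∈ˡ deduplicateᵇ eqF xs
  ∈-dedup⁺ = deduplicate⁺ (T? ∘₂ eqF) λ {x} {y} e z≡x → trans z≡x (sym (eqF-sound y x e))

  ∈-dedup⁻ : ∀ xs {a : Form n m} → a ∈ˡ deduplicateᵇ eqF xs → a ∈ˡ xs
  ∈-dedup⁻ = ∈-deduplicate⁻ (T? ∘₂ eqF)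

  size-pos : (φ : Form n m) → 1 ≤ size φ
  size-pos (var p)   = s≤s z≤n
  size-pos (nvar p)  = s≤s z≤n
  size-pos tt        = s≤s z≤n
  size-pos ff        = s≤s z≤n
  size-pos (a ∧F b)  = s≤s z≤n
  size-pos (a ∨F b)  = s≤s z≤n
  size-pos (⟨ α ⟩ a) = s≤s z≤n
  size-pos ([ α ] a) = s≤s z≤n

  private
    two-distinct : ∀ (φ a : Form n m) rest → a ∈ˡ rest → ¬ φ ≡ a → 2 ≤ length (deduplicateᵇ eqF (φ ∷ rest))
    two-distinct φ a rest a∈ φ≢a =
      s≤s (nonempty (∈-filter⁺ (¬? ∘ T? ∘ eqF φ) (∈-dedup⁺ a∈) (φ≢a ∘ eqF-sound φ a)))
      where
      nonempty : ∀ {xs : List (Form n m)} → a ∈ˡ xs → 1 ≤ length xs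
      nonempty (here _)  = s≤s z≤n
      nonempty (there _) = s≤s z≤n

  size≥2 : (φ : Form n m) → 1 ≤ md φ → 2 ≤ size φ
  size≥2 (a ∧F b)  _ = two-distinct (a ∧F b) a (sub a ++ sub b) (∈-++⁺ˡ (∈-sub-self a)) λ ()
  size≥2 (a ∨F b)  _ = two-distinct (a ∨F b) a (sub a ++ sub b) (∈-++⁺ˡ (∈-sub-self a)) λ ()
  size≥2 (⟨ α ⟩ a) _ = two-distinct (⟨ α ⟩ a) a (sub a) (∈-sub-self a) λ ()
  size≥2 ([ α ] a) _ = two-distinct ([ α ] a) a (sub a) (∈-sub-self a) λ ()

  sub-has-modality-free : (φ : Form n m) → ∃ λ ℓ → ℓ ∈ˡ sub φ × md ℓ ≡ 0
  sub-has-modality-free (var p)   = var p , here refl , refl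
  sub-has-modality-free (nvar p)  = nvar p , here refl , refl
  sub-has-modality-free tt        = tt , here refl , refl
  sub-has-modality-free ff        = ff , here refl , refl
  sub-has-modality-free (a ∧F b)  = let ℓ , h , e = sub-has-modality-free a in ℓ , there (∈-++⁺ˡ h) , e
  sub-has-modality-free (a ∨F b)  = let ℓ , h , e = sub-has-modality-free a in ℓ , there (∈-++⁺ˡ h) , e
  sub-has-modality-free (⟨ α ⟩ a) = let ℓ , h , e = sub-has-modality-free a in ℓ , there h , e
  sub-has-modality-free ([ α ] a) = let ℓ , h , e = sub-has-modality-free a in ℓ , there h , e

module _ {X : Set} where

  count : {P : X → Set} → (∀ a → Dec (P a)) → List X → ℕ
  count P? [] = 0
  count P? (a ∷ l) with P? a
  ... | yes _ = suc (count P? l)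
  ... | no  _ = count P? l

  module _ {P : X → Set} (P? : ∀ a → Dec (P a)) where

    count≤length : ∀ l → count P? l ≤ length l
    count≤length [] = z≤n
    count≤length (a ∷ l) with P? a
    ... | yes _ = s≤s (count≤length l)
    ... | no  _ = m≤n⇒m≤1+n (count≤length l)

    count<length : ∀ {l a} → a ∈ˡ l → ¬ P a → count P? l < length l
    count<length {b ∷ l} (here refl) ¬pb with P? b
    ... | yes pb = ⊥-elim (¬pb pb)
    ... | no  _  = s≤s (count≤length l)
    count<length {b ∷ l} (there a∈) ¬pa with P? b
    ... | yes _ = s≤s (count<length a∈ ¬pa)
    ... | no  _ = m≤n⇒m≤1+n (count<length a∈ ¬pa)

    module _ {Q : X → Set} (Q? : ∀ a → Dec (Q a)) where

      count-mono : ∀ l → (∀ {a} → a ∈ˡ l → Q a → P a) → count Q? l ≤ count P? l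
      count-mono [] Q⇒P = z≤n
      count-mono (a ∷ l) Q⇒P with P? a | Q? a
      ... | yes _  | yes _ = s≤s (count-mono l (Q⇒P ∘ there))
      ... | yes _  | no  _ = m≤n⇒m≤1+n (count-mono l (Q⇒P ∘ there))
      ... | no ¬pa | yes q = ⊥-elim (¬pa (Q⇒P (here refl) q))
      ... | no _   | no  _ = count-mono l (Q⇒P ∘ there)

      count-mono-< : ∀ l → (∀ {a} → a ∈ˡ l → Q a → P a) → ∀ {a} → a ∈ˡ l → P a → ¬ Q a → count Q? l < count P? l
      count-mono-< (b ∷ l) Q⇒P (here refl) pb ¬qb with P? b | Q? b
      ... | _      | yes qb = ⊥-elim (¬qb qb)
      ... | no ¬pb | no _   = ⊥-elim (¬pb pb)
      ... | yes _  | no _   = s≤s (count-mono l (Q⇒P ∘ there))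
      count-mono-< (b ∷ l) Q⇒P (there a∈) pa ¬qa with P? b | Q? b
      ... | yes _  | yes _ = s≤s (count-mono-< l (Q⇒P ∘ there) a∈ pa ¬qa)
      ... | yes _  | no  _ = m≤n⇒m≤1+n (count-mono-< l (Q⇒P ∘ there) a∈ pa ¬qa)
      ... | no ¬pb | yes q = ⊥-elim (¬pb (Q⇒P (here refl) q))
      ... | no _   | no  _ = count-mono-< l (Q⇒P ∘ there) a∈ pa ¬qa

module _ {n m : ℕ} (M : Model n m) where

  ⊨neg⇒⊭ : ∀ {w} (a : Form n m) → M , w ⊨ neg a → ¬ M , w ⊨ a
  ⊨neg⇒⊭ (var p)   h h′ = h h′
  ⊨neg⇒⊭ (nvar p)  h h′ = h′ h
  ⊨neg⇒⊭ ff        h h′ = h′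
  ⊨neg⇒⊭ (a ∧F b)  (inj₁ h) (ha , _) = ⊨neg⇒⊭ a h ha
  ⊨neg⇒⊭ (a ∧F b)  (inj₂ h) (_ , hb) = ⊨neg⇒⊭ b h hb
  ⊨neg⇒⊭ (a ∨F b)  (h , _) (inj₁ ha) = ⊨neg⇒⊭ a h ha
  ⊨neg⇒⊭ (a ∨F b)  (_ , h) (inj₂ hb) = ⊨neg⇒⊭ b h hb
  ⊨neg⇒⊭ (⟨ α ⟩ a) h (v , r , hv) = ⊨neg⇒⊭ a (h v r) hv
  ⊨neg⇒⊭ ([ α ] a) (v , r , hv) h′ = ⊨neg⇒⊭ a hv (h′ v r)

  ⇒F-elim : ∀ {w} (a b : Form n m) → M , w ⊨ (a ⇒F b) → M , w ⊨ a → M , w ⊨ b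
  ⇒F-elim a b (inj₁ h) ha = ⊥-elim (⊨neg⇒⊭ a h ha)
  ⇒F-elim a b (inj₂ h) _  = h

  ⋀-elim : ∀ {w} {as : List (Form n m)} {a} → M , w ⊨ ⋀ as → a ∈ˡ as → M , w ⊨ a
  ⋀-elim (h , _) (here refl) = h
  ⋀-elim (_ , h) (there a∈)  = ⋀-elim h a∈

  ⋀-intro : ∀ {w} (as : List (Form n m)) → (∀ {a} → a ∈ˡ as → M , w ⊨ a) → M , w ⊨ ⋀ as
  ⋀-intro []       h = _
  ⋀-intro (a ∷ as) h = h (here refl) , ⋀-intro as (h ∘ there)

  boxAg-elim : ∀ {w v α} (χ : Form n m) → M , w ⊨ boxAg χ → R M w α v → M , v ⊨ χ
  boxAg-elim {α = α} χ h = ⋀-elim h (∈-map⁺ (λ β → [ β ] χ) (∈-allFin α)) _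

  boxAg-intro : ∀ {w} (χ : Form n m) → (∀ {α v} → R M w α v → M , v ⊨ χ) → M , w ⊨ boxAg χ
  boxAg-intro χ h = ⋀-intro (map (λ β → [ β ] χ) (allFin n)) λ a∈ → case ∈-map⁻ (λ β → [ β ] χ) a∈ of λ where
    (β , _ , refl) → λ v → h

  Inv-head : ∀ {w} d (χ : Form n m) → M , w ⊨ Inv d χ → M , w ⊨ χ
  Inv-head zero    χ h       = h
  Inv-head (suc d) χ (h , _) = Inv-head d χ h

  Inv-step : ∀ {w v α} d (χ : Form n m) → M , w ⊨ Inv (suc d) χ → R M w α v → M , v ⊨ Inv d χ
  Inv-step zero    χ (_ , h)  r = boxAg-elim χ h r
  Inv-step (suc d) χ (h , h′) r = Inv-step d χ h r , boxAg-elim (boxAg^ (suc d) χ) h′ r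

  Inv-antitone : ∀ {w} {j} k (χ : Form n m) → j ≤ k → M , w ⊨ Inv k χ → M , w ⊨ Inv j χ
  Inv-antitone {j = j} k χ j≤k h with m≤n⇒m<n∨m≡n j≤k
  ... | inj₂ refl = h
  Inv-antitone {j = j} (suc k) χ _ (h , _) | inj₁ (s≤s j≤k) = Inv-antitone k χ j≤k h

  boxAg^-valid : (χ : Form n m) → (∀ w → M , w ⊨ χ) → ∀ k w → M , w ⊨ boxAg^ k χ
  boxAg^-valid χ h zero    w = h w
  boxAg^-valid χ h (suc k) w = boxAg-intro (boxAg^ k χ) λ {_} {v} _ → boxAg^-valid χ h k v

  Inv-valid : (χ : Form n m) → (∀ w → M , w ⊨ χ) → ∀ k w → M , w ⊨ Inv k χ
  Inv-valid χ h zero    w = h w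
  Inv-valid χ h (suc k) w = Inv-valid χ h k w , boxAg^-valid χ h (suc k) w

  module Classical (em : ExcludedMiddle 0ℓ) where

    ⊨-stable : ∀ {w} (a : Form n m) → ¬ ¬ M , w ⊨ a → M , w ⊨ a
    ⊨-stable {w} a ¬¬h with em {M , w ⊨ a}
    ... | yes h = h
    ... | no ¬h = ⊥-elim (¬¬h ¬h)

    ⊭⇒⊨neg : ∀ {w} (a : Form n m) → ¬ M , w ⊨ a → M , w ⊨ neg a
    ⊭⇒⊨neg (var p)  h = h
    ⊭⇒⊨neg {w} (nvar p) h with em {V M w p}
    ... | yes v = v
    ... | no ¬v = ⊥-elim (h ¬v)
    ⊭⇒⊨neg tt h = h _
    ⊭⇒⊨neg ff h = _
    ⊭⇒⊨neg {w} (a ∧F b) h with em {M , w ⊨ a}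
    ... | yes ha = inj₂ (⊭⇒⊨neg b λ hb → h (ha , hb))
    ... | no ¬ha = inj₁ (⊭⇒⊨neg a ¬ha)
    ⊭⇒⊨neg (a ∨F b)  h = ⊭⇒⊨neg a (h ∘ inj₁) , ⊭⇒⊨neg b (h ∘ inj₂)
    ⊭⇒⊨neg (⟨ α ⟩ a) h v r = ⊭⇒⊨neg a λ hv → h (v , r , hv)
    ⊭⇒⊨neg {w} ([ α ] a) h with em {Σ (W M) λ v → R M w α v × ¬ M , v ⊨ a}
    ... | yes (v , r , ¬hv) = v , r , ⊭⇒⊨neg a ¬hv
    ... | no ¬cex = ⊥-elim (h λ v r → ⊨-stable a λ ¬hv → ¬cex (v , r , ¬hv))

    ⇒F-intro : ∀ {w} (a b : Form n m) → (M , w ⊨ a → M , w ⊨ b) → M , w ⊨ (a ⇒F b)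
    ⇒F-intro {w} a b h with em {M , w ⊨ a}
    ... | yes ha = inj₂ (h ha)
    ... | no ¬ha = inj₁ (⊭⇒⊨neg a ¬ha)

module _ {n m : ℕ} (em : ExcludedMiddle 0ℓ) (M : Model n m) where

  open Classical M em

  ax-sound : ∀ {α} c → Holds M α c → ∀ (ψ : Form n m) w → M , w ⊨ ax c α ψ
  ax-sound D  h ψ w = let v , r = h w in v , r , _
  ax-sound {α} T  h ψ w = ⇒F-intro ([ α ] ψ) ψ λ □ψ → □ψ w (h w)
  ax-sound {α} B  h ψ w = ⇒F-intro (⟨ α ⟩ [ α ] ψ) ψ λ (v , r , □ψ) → □ψ w (h w v r)
  ax-sound {α} C4 h ψ w = ⇒F-intro ([ α ] ψ) ([ α ] [ α ] ψ) λ □ψ v r u r′ → □ψ u (h w v u r r′)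
  ax-sound {α} C5 h ψ w = ⇒F-intro (⟨ α ⟩ [ α ] ψ) ([ α ] ψ) λ (v , r , □ψ) u r′ → □ψ u (h w v u r r′)

module Translation {n m : ℕ} (x : Cond) (A : Subset n) (φ : Form n m) where

  agentsA : List (Fin n)
  agentsA = filter (_∈? A) (allFin n)

  instances : Form n m → List (Form n m)
  instances ψ = map (λ α → ax x α ψ) agentsA

  axioms : Form n m
  axioms = ⋀ (concatMap instances (subbar φ))

  invDepth : ℕ
  invDepth = if is45 x then md φ * size φ else md φ

  -- the height one modal step may cost in the unravelling: a whole cluster when x is 4 or 5
  stride : ℕ
  stride = if is45 x then size φ else 1

  stride*md≡invDepth : stride * md φ ≡ invDepth
  stride*md≡invDepth with is45 x
  ... | true  = *-comm (size φ) (md φ)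
  ... | false = +-identityʳ (md φ)

  stride-pos : 1 ≤ stride
  stride-pos with is45 x
  ... | true  = size-pos φ
  ... | false = ≤-refl

  stride≡size : is45 x ≡ true → stride ≡ size φ
  stride≡size e = cong (λ b → if b then size φ else 1) e

  stride≥2 : is45 x ≡ true → ∀ {k} → k + stride ≤ invDepth → 2 ≤ stride
  stride≥2 e {k} le with is45 x
  ... | true with md φ in md≡
  ...   | zero  = case ≤-trans (≤-trans (size-pos φ) (m≤n+m (size φ) k)) le of λ ()
  ...   | suc _ = size≥2 φ (subst (1 ≤_) (sym md≡) (s≤s z≤n))

  module _ (M : Model n m) where

    axioms-elim : ∀ {w ψ α} → M , w ⊨ axioms → ψ ∈cl φ → α ∈ A → M , w ⊨ ax x α ψ
    axioms-elim {ψ = ψ} {α} h ψ∈ α∈A = ⋀-elim M h (∈-concatMap⁺ instances (lift (∈cl⇒∈subbar ψ∈)))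
      where
      lift : ∀ {ψs} → ψ ∈ˡ ψs → Any (λ ψ′ → ax x α ψ ∈ˡ instances ψ′) ψs
      lift (here refl) = here (∈-map⁺ (λ β → ax x β ψ) (∈-filter⁺ (_∈? A) (∈-allFin α) α∈A))
      lift (there ψ∈)  = there (lift ψ∈)

    axioms-intro : ∀ {w} → (∀ {α} → α ∈ A → ∀ ψ → M , w ⊨ ax x α ψ) → M , w ⊨ axioms
    axioms-intro {w} h = ⋀-intro M _ λ a∈ → holds (∈-concatMap⁻ instances {xs = subbar φ} a∈)
      where
      holds : ∀ {ψs a} → Any (λ ψ → a ∈ˡ instances ψ) ψs → M , w ⊨ a
      holds (there a∈) = holds a∈
      holds {ψ ∷ _} (here a∈) with ∈-map⁻ (λ α → ax x α ψ) a∈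
      ... | α , α∈ , refl = h (proj₂ (∈-filter⁻ (_∈? A) {xs = allFin n} α∈)) ψ

module _ {n : ℕ} {A : Subset n} {x : Cond} {L₁ L₂ : Logic n}
  (hA : ∀ α → α ∈ A → ∀ c → (L₁ α c ≡ true) ⇔ (L₂ α c ≡ true ⊎ c ≡ x))
  (h∉A : ∀ α → α ∉ A → ∀ c → L₁ α c ≡ L₂ α c) where

  L₂⊆L₁ : ∀ α c → L₂ α c ≡ true → L₁ α c ≡ true
  L₂⊆L₁ α c e with α ∈? A
  ... | yes α∈A = Equivalence.from (hA α α∈A c) (inj₁ e)
  ... | no  α∉A = trans (h∉A α α∉A c) e

  x∈L₁ : ∀ α → α ∈ A → L₁ α x ≡ true
  x∈L₁ α α∈A = Equivalence.from (hA α α∈A x) (inj₂ refl)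

  L₁-split : ∀ α c → L₁ α c ≡ true → L₂ α c ≡ true ⊎ (α ∈ A × c ≡ x)
  L₁-split α c e with α ∈? A
  ... | no α∉A = inj₁ (trans (sym (h∉A α α∉A c)) e)
  ... | yes α∈A with Equivalence.to (hA α α∈A c) e
  ...   | inj₁ e₂  = inj₁ e₂
  ...   | inj₂ c≡x = inj₂ (α∈A , c≡x)

satisfiable⇒tr-satisfiable : ∀ {n m} → ExcludedMiddle 0ℓ → {A : Subset n} {x : Cond} {L₁ L₂ : Logic n} →
  (∀ α c → L₂ α c ≡ true → L₁ α c ≡ true) → (∀ α → α ∈ A → L₁ α x ≡ true) →
  (φ : Form n m) → Satisfiable L₁ φ → Satisfiable L₂ (tr x A φ)
satisfiable⇒tr-satisfiable em {A} {x} L₂⊆L₁ x∈L₁ φ (M , isL₁ , w , hφ) =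
  M , (λ α c e → isL₁ α c (L₂⊆L₁ α c e)) , w , hφ , Inv-valid M axioms axioms-valid invDepth w
  where
  open Translation x A φ
  axioms-valid : ∀ u → M , u ⊨ axioms
  axioms-valid u = axioms-intro M λ α∈A ψ → ax-sound em M x (isL₁ _ x (x∈L₁ _ α∈A)) ψ u

module Unravelling {n m : ℕ} (M : Model n m) (w₀ : W M) where

  data Path : W M → Set where
    root : Path w₀
    step : ∀ {u v} → Path u → (γ : Fin n) → R M u γ v → Path v

  depth : ∀ {u} → Path u → ℕ
  depth root         = 0
  depth (step p _ _) = suc (depth p)

  Node : Set
  Node = Σ (W M) Path

  height : Node → ℕ
  height (_ , p) = depth p

-- Each modal step may raise the height by H, so a formula of modal depth k consumes H * k of the budget d.
module BoundedTransfer {n m : ℕ} (M : Model n m) {W′ : Set} (π : W′ → W M)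
  (R′ : W′ → Fin n → W′ → Set) (height : W′ → ℕ) (H d : ℕ) (φ : Form n m)
  (box-step : ∀ {γ w q θ} → height w + H ≤ d → R′ w γ q → [ γ ] θ ∈cl φ →
              M , π w ⊨ ([ γ ] θ) → M , π q ⊨ θ × height q ≤ height w + H)
  (diamond-step : ∀ {γ w θ} → height w + H ≤ d → ⟨ γ ⟩ θ ∈cl φ → M , π w ⊨ (⟨ γ ⟩ θ) →
                  Σ W′ λ q → R′ w γ q × M , π q ⊨ θ × height q ≤ height w + H) where

  M′ : Model n m
  M′ = record { W = W′ ; R = R′ ; V = V M ∘ π }

  private
    budgetˡ : ∀ {h} (a b : Form n m) → h + H * (md a ⊔ md b) ≤ d → h + H * md a ≤ d
    budgetˡ {h} a b = ≤-trans (+-monoʳ-≤ h (*-monoʳ-≤ H (m≤m⊔n (md a) (md b))))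
    budgetʳ : ∀ {h} (a b : Form n m) → h + H * (md a ⊔ md b) ≤ d → h + H * md b ≤ d
    budgetʳ {h} a b = ≤-trans (+-monoʳ-≤ h (*-monoʳ-≤ H (m≤n⊔m (md a) (md b))))
    spend : ∀ h k → h + H * suc k ≤ d → (h + H) + H * k ≤ d
    spend h k = subst (_≤ d) (trans (cong (h +_) (*-suc H k)) (sym (+-assoc h H (H * k))))
    budget-now : ∀ h k → h + H * suc k ≤ d → h + H ≤ d
    budget-now h k le = ≤-trans (m≤m+n (h + H) (H * k)) (spend h k le)
    budget-later : ∀ h {h′} k → h′ ≤ h + H → h + H * suc k ≤ d → h′ + H * k ≤ d
    budget-later h k h′≤ le = ≤-trans (+-monoˡ-≤ (H * k) h′≤) (spend h k le)

  transfer : ∀ θ → θ ∈cl φ → ∀ w → height w + H * md θ ≤ d → M , π w ⊨ θ → M′ , w ⊨ θ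
  transfer (var p)  _ w _ h = h
  transfer (nvar p) _ w _ h = h
  transfer tt       _ w _ h = h
  transfer (a ∧F b) θ∈ w le (ha , hb) =
    transfer a (∈cl-∧ˡ θ∈) w (budgetˡ a b le) ha , transfer b (∈cl-∧ʳ θ∈) w (budgetʳ a b le) hb
  transfer (a ∨F b) θ∈ w le (inj₁ ha) = inj₁ (transfer a (∈cl-∨ˡ θ∈) w (budgetˡ a b le) ha)
  transfer (a ∨F b) θ∈ w le (inj₂ hb) = inj₂ (transfer b (∈cl-∨ʳ θ∈) w (budgetʳ a b le) hb)
  transfer (⟨ γ ⟩ a) θ∈ w le h with diamond-step (budget-now (height w) (md a) le) θ∈ h
  ... | q , r , hq , q≤ = q , r , transfer a (∈cl-◇ θ∈) q (budget-later (height w) (md a) q≤ le) hq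
  transfer ([ γ ] a) θ∈ w le h q r with box-step (budget-now (height w) (md a) le) r θ∈ h
  ... | hq , q≤ = transfer a (∈cl-□ θ∈) q (budget-later (height w) (md a) q≤ le) hq

Satisfies : {X : Set} → (X → X → Set) → Cond → Set
Satisfies _∼_ D  = ∀ w → ∃ (w ∼_)
Satisfies _∼_ T  = ∀ w → w ∼ w
Satisfies _∼_ B  = ∀ w v → w ∼ v → v ∼ w
Satisfies _∼_ C4 = ∀ w v u → w ∼ v → v ∼ u → w ∼ u
Satisfies _∼_ C5 = ∀ w v u → w ∼ v → w ∼ u → v ∼ u

satisfies⇒holds : ∀ {n m} (M : Model n m) α c → Satisfies (λ w v → R M w α v) c → Holds M α c
satisfies⇒holds M α D  h = h
satisfies⇒holds M α T  h = h
satisfies⇒holds M α B  h = h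
satisfies⇒holds M α C4 h = h
satisfies⇒holds M α C5 h = h

module Backward {n m : ℕ} (em : ExcludedMiddle 0ℓ) {A : Subset n} {x : Cond} {L₁ L₂ : Logic n}
  (L₁-split : ∀ γ c → L₁ γ c ≡ true → L₂ γ c ≡ true ⊎ (γ ∈ A × c ≡ x))
  (L₂⊆L₁ : ∀ γ c → L₂ γ c ≡ true → L₁ γ c ≡ true) (x∈L₁ : ∀ γ → γ ∈ A → L₁ γ x ≡ true)
  (L₂≺x : ∀ γ c → L₂ γ c ≡ true → c ≺ x)
  (φ : Form n m) (M : Model n m) (isL₂ : IsLModel L₂ M) (w₀ : W M)
  (w₀⊨inv : M , w₀ ⊨ Inv (Translation.invDepth x A φ) (Translation.axioms x A φ)) where

  open Translation x A φ
  open Unravelling M w₀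
  open Classical M em

  Inv-along : ∀ {u} (p : Path u) k → depth p + k ≤ invDepth → M , u ⊨ Inv k axioms
  Inv-along root         k le = Inv-antitone M invDepth axioms le w₀⊨inv
  Inv-along (step p γ r) k le = Inv-step M k axioms (Inv-along p (suc k) (subst (_≤ invDepth) (sym (+-suc (depth p) k)) le)) r

  axioms-at : ∀ {u} (p : Path u) → depth p ≤ invDepth → ∀ {γ ψ} → γ ∈ A → ψ ∈cl φ → M , u ⊨ ax x γ ψ
  axioms-at p le γ∈A ψ∈ =
    axioms-elim M (Inv-head M 0 axioms (Inv-along p 0 (subst (_≤ invDepth) (sym (+-identityʳ _)) le))) ψ∈ γ∈A

  frame-or-axioms : ∀ {γ c u} (p : Path u) → depth p ≤ invDepth → L₁ γ c ≡ true →
                    Holds M γ c ⊎ (∀ {ψ} → ψ ∈cl φ → M , u ⊨ ax c γ ψ)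
  frame-or-axioms {γ} {c} p le e with L₁-split γ c e
  ... | inj₁ e₂ = inj₁ (isL₂ γ c e₂)
  ... | inj₂ (γ∈A , refl) = inj₂ (axioms-at p le γ∈A)

  BoxStep : Fin n → (Node → Node → Set) → Set
  BoxStep γ _∼_ = ∀ {w q θ} → height w + stride ≤ invDepth → w ∼ q → [ γ ] θ ∈cl φ →
                  M , proj₁ w ⊨ ([ γ ] θ) → M , proj₁ q ⊨ θ × height q ≤ height w + stride

  DiamondStep : Fin n → (Node → Node → Set) → Set
  DiamondStep γ _∼_ = ∀ {w θ} → height w + stride ≤ invDepth → ⟨ γ ⟩ θ ∈cl φ → M , proj₁ w ⊨ (⟨ γ ⟩ θ) →
                      Σ Node λ q → w ∼ q × M , proj₁ q ⊨ θ × height q ≤ height w + stride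

  record Adequate (γ : Fin n) : Set₁ where
    field
      _∼_          : Node → Node → Set
      frame        : ∀ c → L₁ γ c ≡ true → Satisfies _∼_ c
      box-step     : BoxStep γ _∼_
      diamond-step : DiamondStep γ _∼_

  suc≤+stride : ∀ k → suc k ≤ k + stride
  suc≤+stride k = subst (_≤ k + stride) (+-comm k 1) (+-monoʳ-≤ k stride-pos)

  module Local (γ : Fin n) (4∉L₁ : ¬ L₁ γ C4 ≡ true) (5∉L₁ : ¬ L₁ γ C5 ≡ true) where

    data _∼_ : Node → Node → Set where
      child    : ∀ {u v} (p : Path u) (r : R M u γ v) → (u , p) ∼ (v , step p γ r)
      loop     : ∀ {w} → L₁ γ T ≡ true → w ∼ w
      parent   : ∀ {u v} (p : Path u) (r : R M u γ v) → L₁ γ B ≡ true → (v , step p γ r) ∼ (u , p)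
      dead-end : ∀ {u} (p : Path u) → L₁ γ D ≡ true → ¬ ∃ (R M u γ) → (u , p) ∼ (u , p)

    frame : ∀ c → L₁ γ c ≡ true → Satisfies _∼_ c
    frame D e (u , p) with em {∃ (R M u γ)}
    ... | yes (v , r) = (v , step p γ r) , child p r
    ... | no  dead    = (u , p) , dead-end p e dead
    frame T e w = loop e
    frame B e _ _ (child p r)        = parent p r e
    frame B e _ _ (loop t)           = loop t
    frame B e _ _ (parent p r _)     = child p r
    frame B e _ _ (dead-end p t end) = dead-end p t end
    frame C4 e = ⊥-elim (4∉L₁ e)
    frame C5 e = ⊥-elim (5∉L₁ e)

    box-step : BoxStep γ _∼_
    box-step le (child p r) θ∈ h = h _ r , suc≤+stride (depth p)
    box-step {u , p} {θ = θ} le (loop e) θ∈ h with frame-or-axioms p (≤-trans (m≤m+n _ _) le) e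
    ... | inj₁ refl′ = h u (refl′ u) , m≤m+n _ _
    ... | inj₂ axT   = ⇒F-elim M ([ γ ] θ) θ (axT (∈cl-□ θ∈)) h , m≤m+n _ _
    box-step {v , _} {θ = θ} le (parent {u} p r e) θ∈ h with frame-or-axioms p (≤-trans (n≤1+n _) (≤-trans (m≤m+n _ _) le)) e
    ... | inj₁ sym′ = h u (sym′ u v r) , ≤-trans (n≤1+n _) (m≤m+n _ _)
    ... | inj₂ axB  = ⇒F-elim M (⟨ γ ⟩ [ γ ] θ) θ (axB (∈cl-□ θ∈)) (v , r , h) , ≤-trans (n≤1+n _) (m≤m+n _ _)
    box-step le (dead-end {u} p e dead) θ∈ h with frame-or-axioms p (≤-trans (m≤m+n _ _) le) e
    ... | inj₁ serial = ⊥-elim (dead (serial u))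
    ... | inj₂ axD    = ⊥-elim (let v , r , _ = axD (∈cl-self {φ = φ}) in dead (v , r))

    diamond-step : DiamondStep γ _∼_
    diamond-step {_ , p} le θ∈ (v , r , hv) = (v , step p γ r) , child p r , hv , suc≤+stride (depth p)

    adequate : Adequate γ
    adequate = record { _∼_ = _∼_ ; frame = frame ; box-step = box-step ; diamond-step = diamond-step }

  Ax5 : Fin n → W M → Set
  Ax5 γ u = ∀ {ψ} → ψ ∈cl φ → M , u ⊨ (⟨ γ ⟩ [ γ ] ψ) → M , u ⊨ ([ γ ] ψ)

  module _ {γ : Fin n} where

    □-from-successor : ∀ {u c θ} → Ax5 γ u → R M u γ c → [ γ ] θ ∈cl φ → M , c ⊨ ([ γ ] θ) → M , u ⊨ ([ γ ] θ)
    □-from-successor ax₅ r θ∈ h = ax₅ (∈cl-□ θ∈) (_ , r , h)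

    -- The axiom at u instantiated with ⟨γ⟩¬θ forces all successors of u to agree on [γ]θ.
    □-to-successor : ∀ {u c θ} → Ax5 γ u → Ax5 γ c → R M u γ c → [ γ ] θ ∈cl φ →
                     M , u ⊨ (⟨ γ ⟩ [ γ ] θ) → M , c ⊨ ([ γ ] θ)
    □-to-successor {θ = θ} axᵤ axc r □θ∈ (v , rv , hv) = ⊨-stable ([ γ ] θ) λ c⊭ →
      let c⊨□◇¬θ : M , _ ⊨ ([ γ ] ⟨ γ ⟩ neg θ)
          c⊨□◇¬θ e re = ⊭⇒⊨neg ([ γ ] θ) λ he → c⊭ (axc (∈cl-□ □θ∈) (e , re , he))
      in ⊨neg⇒⊭ M ([ γ ] θ) (axᵤ (∈cl-neg □θ∈) (_ , r , c⊨□◇¬θ) v rv) hv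

    □-to-grandchild : ∀ {u c e θ} → Ax5 γ u → Ax5 γ c → Ax5 γ e → R M u γ c → R M c γ e →
                      [ γ ] θ ∈cl φ → M , c ⊨ ([ γ ] θ) → M , e ⊨ ([ γ ] θ)
    □-to-grandchild {θ = θ} axᵤ axc axₑ r r′ □θ∈ hc = ⊨-stable ([ γ ] θ) λ e⊭ →
      let e⊨□◇¬θ : M , _ ⊨ ([ γ ] ⟨ γ ⟩ neg θ)
          e⊨□◇¬θ f rf = ⊭⇒⊨neg ([ γ ] θ) λ hf → e⊭ (axₑ (∈cl-□ □θ∈) (f , rf , hf))
          c⊨□◇¬θ = axc (∈cl-neg □θ∈) (_ , r′ , e⊨□◇¬θ)
      in ⊨neg⇒⊭ M ([ γ ] θ) (axᵤ (∈cl-neg □θ∈) (_ , r , c⊨□◇¬θ) _ r) hc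

  data Layer : Set where
    top mid low : Layer

  next : Layer → Layer
  next top = mid
  next mid = low
  next low = top

  -- Maximal γ-chains of the unravelling are cut into clusters of three consecutive layers.
  module Clusters (γ : Fin n) where

    private
      layer-step : ∀ {β} → Dec (β ≡ γ) → Layer → Layer
      layer-step (yes _) l = next l
      layer-step (no _)  _ = top

      root-step : ∀ {β} → Dec (β ≡ γ) → Layer → Node → Node → Node
      root-step (yes _) top above _ = above
      root-step (yes _) mid above _ = above
      root-step (yes _) low _ self = self
      root-step (no _)  _   _ self = self

    layer : ∀ {u} → Path u → Layer
    layer root         = top
    layer (step p β _) = layer-step (β ≟ γ) (layer p)

    clusterRoot : ∀ {u} → Path u → Node
    clusterRoot root             = w₀ , root
    clusterRoot {v} (step p β r) = root-step (β ≟ γ) (layer p) (clusterRoot p) (v , step p β r)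

    rootOf : Node → Node
    rootOf (_ , p) = clusterRoot p

    layerOf : Node → Layer
    layerOf (_ , p) = layer p

    clusterRoot-top : ∀ {u} (p : Path u) → layer p ≡ top → clusterRoot p ≡ (u , p)
    clusterRoot-top root e = refl
    clusterRoot-top (step p β r) e with β ≟ γ | layer p
    ... | yes _ | low = refl
    ... | no _  | _   = refl

    layer-γ : ∀ {u v} (p : Path u) (r : R M u γ v) → layer (step p γ r) ≡ next (layer p)
    layer-γ p r with γ ≟ γ
    ... | yes _ = refl
    ... | no γ≢γ = ⊥-elim (γ≢γ refl)

    layer-other : ∀ {u v β} (p : Path u) (r : R M u β v) → ¬ β ≡ γ → layer (step p β r) ≡ top
    layer-other {β = β} p r β≢γ with β ≟ γ
    ... | yes β≡γ = ⊥-elim (β≢γ β≡γ)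
    ... | no _    = refl

    layer-child : ∀ {u v} (p : Path u) (r : R M u γ v) → layer p ≡ top → layer (step p γ r) ≡ mid
    layer-child p r e = trans (layer-γ p r) (cong next e)

    layer-grandchild : ∀ {u v w} (p : Path u) (r : R M u γ v) (r′ : R M v γ w) → layer p ≡ top →
                       layer (step (step p γ r) γ r′) ≡ low
    layer-grandchild p r r′ e = trans (layer-γ (step p γ r) r′) (cong next (layer-child p r e))

    clusterRoot-child : ∀ {u v} (p : Path u) (r : R M u γ v) → layer p ≡ top → clusterRoot (step p γ r) ≡ (u , p)
    clusterRoot-child p r e with γ ≟ γ
    ... | no γ≢γ = ⊥-elim (γ≢γ refl)
    ... | yes _ rewrite e = clusterRoot-top p e

    clusterRoot-grandchild : ∀ {u v w} (p : Path u) (r : R M u γ v) (r′ : R M v γ w) → layer p ≡ top →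
                             clusterRoot (step (step p γ r) γ r′) ≡ (u , p)
    clusterRoot-grandchild p r r′ e with γ ≟ γ
    ... | no γ≢γ = ⊥-elim (γ≢γ refl)
    ... | yes _ rewrite e = clusterRoot-top p e

    data InCluster : Node → Node → Set where
      self       : ∀ {u} (p : Path u) → layer p ≡ top → InCluster (u , p) (u , p)
      child      : ∀ {u v} (p : Path u) → layer p ≡ top → (r : R M u γ v) → InCluster (u , p) (v , step p γ r)
      grandchild : ∀ {u v w} (p : Path u) → layer p ≡ top → (r : R M u γ v) (r′ : R M v γ w) →
                   InCluster (u , p) (w , step (step p γ r) γ r′)

    view : ∀ {u} (q : Path u) → InCluster (clusterRoot q) (u , q)
    view root = self root refl
    view (step p β r) with β ≟ γ | layer p in e
    ... | no β≢γ   | _   = self (step p β r) (layer-other p r β≢γ)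
    ... | yes refl | top rewrite clusterRoot-top p e = child p e r
    ... | yes refl | low = self (step p γ r) (trans (layer-γ p r) (cong next e))
    ... | yes refl | mid with clusterRoot p | view p
    ...   | _ | self _ e′ = case trans (sym e) e′ of λ ()
    ...   | _ | child p′ e′ r′ = grandchild p′ e′ r′ r
    ...   | _ | grandchild p′ e′ r′ r″ = case trans (sym e) (layer-grandchild p′ r′ r″ e′) of λ ()

    InCluster⇒root : ∀ {r q} → InCluster r q → rootOf q ≡ r
    InCluster⇒root (self p e)             = clusterRoot-top p e
    InCluster⇒root (child p e r)          = clusterRoot-child p r e
    InCluster⇒root (grandchild p e r r′)  = clusterRoot-grandchild p r r′ e

    InCluster-height≤ : ∀ {r q} → InCluster r q → height q ≤ height r + 2
    InCluster-height≤ (self p _)             = m≤m+n _ _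
    InCluster-height≤ (child p _ _)          = subst (_≤ depth p + 2) (+-comm (depth p) 1) (+-monoʳ-≤ (depth p) (s≤s z≤n))
    InCluster-height≤ (grandchild p _ _ _)   = ≤-reflexive (+-comm 2 (depth p))

    InCluster-height≥ : ∀ {r q} → InCluster r q → height r ≤ height q
    InCluster-height≥ (self _ _)             = ≤-refl
    InCluster-height≥ (child _ _ _)          = n≤1+n _
    InCluster-height≥ (grandchild _ _ _ _)   = ≤-trans (n≤1+n _) (n≤1+n _)

  module Euclidean (γ : Fin n) (x≡5 : x ≡ C5) (γ∈A : γ ∈ A) where

    open Clusters γ

    L₁⇒L₂ : ∀ {c} → ¬ c ≡ C5 → L₁ γ c ≡ true → L₂ γ c ≡ true
    L₁⇒L₂ {c} c≢5 e with L₁-split γ c e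
    ... | inj₁ e₂ = e₂
    ... | inj₂ (_ , c≡x) = ⊥-elim (c≢5 (trans c≡x x≡5))

    Safe : Node → Set
    Safe r = height r + 2 ≤ invDepth

    -- Members below the root are seen by the whole cluster; the root only when reflexivity, or
    -- symmetry through a successor, lets it inherit its own boxes.
    Visible : Node → Set
    Visible (u , p) = layer p ≡ top → L₂ γ T ≡ true ⊎ (L₂ γ B ≡ true × ∃ (R M u γ))

    Sees : Node → Node → Set
    Sees w q = Visible q × (Visible w ⊎ layerOf q ≡ mid ⊎ L₂ γ C4 ≡ true)

    _∼_ : Node → Node → Set
    w ∼ q = rootOf w ≡ rootOf q × (Safe (rootOf w) → Sees w q)

    visible-below : ∀ {w} → layerOf w ≡ mid ⊎ layerOf w ≡ low → Visible w
    visible-below (inj₁ mid≡) atTop = case trans (sym mid≡) atTop of λ ()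
    visible-below (inj₂ low≡) atTop = case trans (sym low≡) atTop of λ ()

    invisible⇒top : ∀ w → ¬ Visible w → layerOf w ≡ top
    invisible⇒top w invisible = go (layerOf w) refl
      where
      go : ∀ l → layerOf w ≡ l → layerOf w ≡ top
      go top e = e
      go mid e = ⊥-elim (invisible (visible-below {w} (inj₁ e)))
      go low e = ⊥-elim (invisible (visible-below {w} (inj₂ e)))

    visible-sym : L₂ γ B ≡ true → ∀ w q → rootOf w ≡ rootOf q → Visible q → Visible w
    visible-sym eB (u , p) (v , q) same visible atTop = go (subst (λ z → InCluster z (v , q)) root≡ (view q)) visible
      where
      root≡ : clusterRoot q ≡ (u , p)
      root≡ = trans (sym same) (clusterRoot-top p atTop)
      go : ∀ {w} → InCluster (u , p) w → Visible w → _
      go (self _ _)            vis = vis atTop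
      go (child _ _ r)         _   = inj₂ (eB , _ , r)
      go (grandchild _ _ r _)  _   = inj₂ (eB , _ , r)

    frame : ∀ c → L₁ γ c ≡ true → Satisfies _∼_ c
    frame D e (u , p) with em {Visible (u , p)}
    ... | yes vis = (u , p) , refl , λ _ → vis , inj₁ vis
    ... | no invis with isL₂ γ D (L₁⇒L₂ (λ ()) e) u
    ...   | v , r = (v , step p γ r) , trans (clusterRoot-top p atTop) (sym (clusterRoot-child p r atTop)) ,
                    λ _ → visible-below {v , step p γ r} (inj₁ (layer-child p r atTop)) , inj₂ (inj₁ (layer-child p r atTop))
      where atTop = invisible⇒top (u , p) invis
    frame T e w = refl , λ _ → vis , inj₁ vis
      where vis = λ _ → inj₁ (L₁⇒L₂ (λ ()) e)
    frame B e w q (same , f) = sym same , λ safe →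
      let vis-q , _ = f (subst Safe (sym same) safe)
      in visible-sym (L₁⇒L₂ (λ ()) e) w q same vis-q , inj₁ vis-q
    frame C4 e w q s (same₁ , f₁) (same₂ , f₂) = trans same₁ same₂ , λ safe →
      proj₁ (f₂ (subst Safe same₁ safe)) , map₂ (λ _ → inj₂ (L₁⇒L₂ (λ ()) e)) (proj₂ (f₁ safe))
    frame C5 e w q s (same₁ , f₁) (same₂ , f₂) = trans (sym same₁) same₂ , λ safe →
      let safe′ = subst Safe (sym same₁) safe in proj₁ (f₂ safe′) , inj₁ (proj₁ (f₁ safe′))

    ax5-at : ∀ {u} (p : Path u) → depth p ≤ invDepth → Ax5 γ u
    ax5-at p le {ψ} ψ∈ =
      ⇒F-elim M (⟨ γ ⟩ [ γ ] ψ) ([ γ ] ψ) (subst (λ c → M , _ ⊨ ax c γ ψ) x≡5 (axioms-at p le γ∈A ψ∈))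

    module SafeCluster {u} (p : Path u) (safe : depth p + 2 ≤ invDepth) where

      private
        safe′ : suc (suc (depth p)) ≤ invDepth
        safe′ = subst (_≤ invDepth) (+-comm (depth p) 2) safe

      ax5-root : Ax5 γ u
      ax5-root = ax5-at p (≤-trans (n≤1+n _) (≤-trans (n≤1+n _) safe′))

      ax5-child : ∀ {c} → R M u γ c → Ax5 γ c
      ax5-child r = ax5-at (step p γ r) (≤-trans (n≤1+n _) safe′)

      ax5-grandchild : ∀ {c e} → R M u γ c → R M c γ e → Ax5 γ e
      ax5-grandchild r r′ = ax5-at (step (step p γ r) γ r′) safe′

      Boxed : Form n m → Set
      Boxed θ = M , u ⊨ ([ γ ] θ) × (∀ {c} → R M u γ c → M , c ⊨ ([ γ ] θ))

      boxed-from-child : ∀ {c θ} → [ γ ] θ ∈cl φ → R M u γ c → M , c ⊨ ([ γ ] θ) → Boxed θ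
      boxed-from-child θ∈ r h =
        □-from-successor ax5-root r θ∈ h ,
        λ r′ → □-to-successor ax5-root (ax5-child r′) r′ θ∈ (_ , r , h)

      boxed⇒θ : ∀ {θ q} → Boxed θ → InCluster (u , p) q → Visible q → M , proj₁ q ⊨ θ
      boxed⇒θ (□θ , □θ′) (self _ atTop) vis with vis atTop
      ... | inj₁ eT = □θ u (isL₂ γ T eT u)
      ... | inj₂ (eB , c , r) = □θ′ r u (isL₂ γ B eB u c r)
      boxed⇒θ (□θ , _)  (child _ _ r)         _ = □θ _ r
      boxed⇒θ (_ , □θ′) (grandchild _ _ r r′) _ = □θ′ r _ r′

    box-within : ∀ {r w q θ} → Safe r → InCluster r w → InCluster r q → Sees w q →
                 [ γ ] θ ∈cl φ → M , proj₁ w ⊨ ([ γ ] θ) → M , proj₁ q ⊨ θ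
    box-within {u , p} safe (self _ atTop) (self _ _) (vis , _) θ∈ h with vis atTop
    ... | inj₁ eT = h u (isL₂ γ T eT u)
    ... | inj₂ (eB , c , r) = SafeCluster.ax5-child p safe r (∈cl-□ θ∈) (u , isL₂ γ B eB u c r , h) u (isL₂ γ B eB u c r)
    box-within safe (self _ _) (child _ _ r) _ θ∈ h = h _ r
    box-within {u , p} {θ = θ} safe (self _ atTop) (grandchild _ _ r r′) (_ , how) θ∈ h = c⊨□θ how _ r′
      where
      open SafeCluster p safe
      c⊨□θ : Visible (u , p) ⊎ layer (step (step p γ r) γ r′) ≡ mid ⊎ L₂ γ C4 ≡ true → M , _ ⊨ ([ γ ] θ)
      c⊨□θ (inj₁ vis) with vis atTop
      ... | inj₁ eT = □-to-successor ax5-root (ax5-child r) r θ∈ (u , isL₂ γ T eT u , h)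
      ... | inj₂ (eB , _) = ax5-child r (∈cl-□ θ∈) (u , isL₂ γ B eB u _ r , h)
      c⊨□θ (inj₂ (inj₁ mid≡)) = case trans (sym (layer-grandchild p r r′ atTop)) mid≡ of λ ()
      c⊨□θ (inj₂ (inj₂ e4)) = λ z r″ → h z (isL₂ γ C4 e4 u _ z r r″)
    box-within {θ = θ} safe (child p _ r) inq (vis , _) θ∈ h =
      SafeCluster.boxed⇒θ p safe {θ} (SafeCluster.boxed-from-child p safe θ∈ r h) inq vis
    box-within {θ = θ} safe (grandchild p _ r r′) inq (vis , _) θ∈ h =
      boxed⇒θ {θ} (boxed-from-child θ∈ r (□-from-successor (ax5-child r) r′ θ∈ h)) inq vis
      where open SafeCluster p safe

    diamond-within : ∀ {r w θ} → Safe r → InCluster r w → ⟨ γ ⟩ θ ∈cl φ → M , proj₁ w ⊨ (⟨ γ ⟩ θ) →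
                     Σ Node λ q → InCluster r q × Sees w q × M , proj₁ q ⊨ θ
    diamond-within safe (self p atTop) θ∈ (v , r , hv) =
      (v , step p γ r) , child p atTop r ,
      (visible-below {v , step p γ r} (inj₁ mid≡) , inj₂ (inj₁ mid≡)) , hv
      where mid≡ = layer-child p r atTop
    diamond-within safe (child p atTop r) θ∈ (e , r′ , he) =
      (e , step (step p γ r) γ r′) , grandchild p atTop r r′ ,
      (visible-below {e , step (step p γ r) γ r′} (inj₂ (layer-grandchild p r r′ atTop)) ,
       inj₁ (visible-below {_ , step p γ r} (inj₁ (layer-child p r atTop)))) , he
    diamond-within {θ = θ} safe (grandchild p atTop r r′) θ∈ he with c⊨◇θ
      where
      open SafeCluster p safe
      c⊨◇θ : M , _ ⊨ (⟨ γ ⟩ θ)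
      c⊨◇θ = ⊨-stable (⟨ γ ⟩ θ) λ c⊭ → ⊨neg⇒⊭ M (⟨ γ ⟩ θ)
        (□-to-grandchild ax5-root (ax5-child r) (ax5-grandchild r r′) r r′ (∈cl-neg θ∈) (⊭⇒⊨neg (⟨ γ ⟩ θ) c⊭)) he
    ... | e′ , r″ , he′ =
      (e′ , step (step p γ r) γ r″) , grandchild p atTop r r″ ,
      (visible-below {e′ , step (step p γ r) γ r″} (inj₂ (layer-grandchild p r r″ atTop)) ,
       inj₁ (visible-below {_ , step (step p γ r) γ r′} (inj₂ (layer-grandchild p r r′ atTop)))) , he′

    cluster-fits : ∀ {u} (p : Path u) → depth p + stride ≤ invDepth → height (clusterRoot p) + 2 ≤ depth p + stride
    cluster-fits p le = +-mono-≤ (InCluster-height≥ (view p)) (stride≥2 (cong is45 x≡5) le)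

    box-step : BoxStep γ _∼_
    box-step {u , p} {v , q} le (same , f) θ∈ h =
      box-within safe (view p) inq (f safe) θ∈ h , ≤-trans (InCluster-height≤ inq) (cluster-fits p le)
      where
      safe = ≤-trans (cluster-fits p le) le
      inq = subst (λ z → InCluster z (v , q)) (sym same) (view q)

    diamond-step : DiamondStep γ _∼_
    diamond-step {u , p} le θ∈ h with diamond-within (≤-trans (cluster-fits p le) le) (view p) θ∈ h
    ... | q , inq , sees , hq =
      q , (sym (InCluster⇒root inq) , λ _ → sees) , hq , ≤-trans (InCluster-height≤ inq) (cluster-fits p le)

    adequate : Adequate γ
    adequate = record { _∼_ = _∼_ ; frame = frame ; box-step = box-step ; diamond-step = diamond-step }

  data Role : Set where
    start grow stall : Role

  module Transitive (γ : Fin n) (4∈L₁ : L₁ γ C4 ≡ true) (x∈45 : is45 x ≡ true) (5∉L₁ : ¬ L₁ γ C5 ≡ true) where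

    L₁⇒L₂ : ∀ {c} → is45 c ≡ false → L₁ γ c ≡ true → L₂ γ c ≡ true
    L₁⇒L₂ {c} c∉45 e with L₁-split γ c e
    ... | inj₁ e₂ = e₂
    ... | inj₂ (_ , refl) = case trans (sym c∉45) x∈45 of λ ()

    Inherits : W M → W M → Set
    Inherits u v = ∀ {θ} → [ γ ] θ ∈cl φ → M , u ⊨ ([ γ ] θ) → M , v ⊨ θ × M , v ⊨ ([ γ ] θ)

    Covers : W M → W M → Set
    Covers u v = ∀ {θ} → [ γ ] θ ∈cl φ → M , v ⊨ ([ γ ] θ) → M , u ⊨ ([ γ ] θ)

    inherits-trans : ∀ {u v w} → Inherits u v → Inherits v w → Inherits u w
    inherits-trans i₁ i₂ θ∈ h = i₂ θ∈ (proj₂ (i₁ θ∈ h))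

    covers-inherits : ∀ {u v w} → Covers u v → Inherits u w → Inherits v w
    covers-inherits c i θ∈ h = i θ∈ (c θ∈ h)

    inherits-refl : L₂ γ T ≡ true → ∀ u → Inherits u u
    inherits-refl eT u θ∈ h = h u (isL₂ γ T eT u) , h

    ax4-at : ∀ {u} (p : Path u) → depth p ≤ invDepth → ∀ {θ} → [ γ ] θ ∈cl φ →
             M , u ⊨ ([ γ ] θ) → M , u ⊨ ([ γ ] [ γ ] θ)
    ax4-at p le {θ} θ∈ h with frame-or-axioms p le 4∈L₁
    ... | inj₁ transitive = λ v r w r′ → h w (transitive _ v w r r′)
    ... | inj₂ ax4        = ⇒F-elim M ([ γ ] θ) ([ γ ] [ γ ] θ) (ax4 (∈cl-□ θ∈)) h

    inherits-child : ∀ {u v} (p : Path u) → depth p ≤ invDepth → R M u γ v → Inherits u v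
    inherits-child p le r θ∈ h = h _ r , ax4-at p le θ∈ h _ r

    inherits-parent : L₂ γ B ≡ true → ∀ {u v} (c : Path v) → depth c ≤ invDepth → R M u γ v → Inherits v u
    inherits-parent eB {u} {v} c le r θ∈ h = h u (isL₂ γ B eB u v r) , ax4-at c le θ∈ h u (isL₂ γ B eB u v r)

    -- The γ-modal subformulas of φ whose box (of θ, resp. of ¬θ) fails at u. Their number drops
    -- along every γ-edge that gains a box, which keeps clusters shorter than |φ|.
    Unboxed : W M → Form n m → Set
    Unboxed u ([ β ] θ) = β ≡ γ × ¬ M , u ⊨ ([ γ ] θ)
    Unboxed u (⟨ β ⟩ θ) = β ≡ γ × ¬ M , u ⊨ ([ γ ] neg θ)
    Unboxed u _         = ⊥

    unboxed : W M → ℕ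
    unboxed u = count {P = Unboxed u} (λ _ → em) (deduplicateᵇ eqF (sub φ))

    unboxed<size : ∀ u → unboxed u < size φ
    unboxed<size u =
      let ℓ , ℓ∈ , md≡0 = sub-has-modality-free φ
      in count<length {P = Unboxed u} (λ _ → em) (∈-dedup⁺ ℓ∈) (modality-free md≡0)
      where
      modality-free : ∀ {ℓ} → md ℓ ≡ 0 → ¬ Unboxed u ℓ
      modality-free {[ _ ] _} () _
      modality-free {⟨ _ ⟩ _} () _

    Unboxed-antitone : ∀ {u v} → Inherits u v → ∀ {ξ} → ξ ∈ˡ deduplicateᵇ eqF (sub φ) → Unboxed v ξ → Unboxed u ξ
    Unboxed-antitone i {[ _ ] θ} ξ∈ (refl , v⊭) =
      refl , λ u⊨ → v⊭ (proj₂ (i (inj₁ (∈-dedup⁻ (sub φ) ξ∈)) u⊨))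
    Unboxed-antitone i {⟨ _ ⟩ θ} ξ∈ (refl , v⊭) =
      refl , λ u⊨ → v⊭ (proj₂ (i (∈cl-neg (inj₁ (∈-dedup⁻ (sub φ) ξ∈))) u⊨))

    unboxed-decreasing : ∀ {u v} → Inherits u v → ¬ Covers u v → unboxed v < unboxed u
    unboxed-decreasing {u} {v} i ¬covers
      with em {Σ (Form n m) λ θ → [ γ ] θ ∈cl φ × M , v ⊨ ([ γ ] θ) × ¬ M , u ⊨ ([ γ ] θ)}
    ... | no ¬gap = ⊥-elim (¬covers λ {θ} θ∈ hv → ⊨-stable ([ γ ] θ) λ u⊭ → ¬gap (θ , θ∈ , hv , u⊭))
    ... | yes (θ , inj₁ □θ∈ , hv , u⊭) =
      count-mono-< (λ _ → em) (λ _ → em) _ (Unboxed-antitone i) (∈-dedup⁺ □θ∈) (refl , u⊭) λ (_ , v⊭) → v⊭ hv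
    ... | yes (θ , inj₂ ◇¬θ∈ , hv , u⊭) =
      count-mono-< (λ _ → em) (λ _ → em) _ (Unboxed-antitone i) (∈-dedup⁺ ◇¬θ∈)
        (refl , λ u⊨ → u⊭ (subst (λ t → M , u ⊨ ([ γ ] t)) (neg-involutive θ) u⊨))
        (λ (_ , v⊭) → v⊭ (subst (λ t → M , v ⊨ ([ γ ] t)) (sym (neg-involutive θ)) hv))

    private
      role-step : ∀ {β} → Dec (β ≡ γ) → Role → ∀ {u v} → Dec (Covers u v) → Role
      role-step (yes _) stall _       = start
      role-step (yes _) _     (yes _) = stall
      role-step (yes _) _     (no _)  = grow
      role-step (no _)  _     _       = start

      root-step : ∀ {β} → Dec (β ≡ γ) → Role → Node → Node → Node
      root-step (yes _) stall _     self = self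
      root-step (yes _) _     above _    = above
      root-step (no _)  _     _     self = self

    -- A cluster grows along γ-edges that strictly add boxes and ends one edge after the boxes stop changing.
    role : ∀ {u} → Path u → Role
    role root                 = start
    role (step {u} {v} p β _) = role-step (β ≟ γ) (role p) (em {Covers u v})

    clusterRoot : ∀ {u} → Path u → Node
    clusterRoot root             = w₀ , root
    clusterRoot {v} (step p β r) = root-step (β ≟ γ) (role p) (clusterRoot p) (v , step p β r)

    rootOf : Node → Node
    rootOf (_ , p) = clusterRoot p

    clusterRoot-start : ∀ {u} (p : Path u) → role p ≡ start → clusterRoot p ≡ (u , p)
    clusterRoot-start root e = refl
    clusterRoot-start {v} (step {u} p β r) e with β ≟ γ | role p | em {Covers u v}
    clusterRoot-start (step p β r) () | yes _ | start | yes _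
    clusterRoot-start (step p β r) () | yes _ | start | no _
    clusterRoot-start (step p β r) () | yes _ | grow  | yes _
    clusterRoot-start (step p β r) () | yes _ | grow  | no _
    ... | yes _ | stall | _ = refl
    ... | no _  | _     | _ = refl

    role-γ : ∀ {u v} (p : Path u) (r : R M u γ v) → ¬ role p ≡ stall →
             (Covers u v × role (step p γ r) ≡ stall) ⊎ (¬ Covers u v × role (step p γ r) ≡ grow)
    role-γ {u} {v} p r ¬stall with γ ≟ γ | role p | em {Covers u v}
    ... | no γ≢γ | _     | _         = ⊥-elim (γ≢γ refl)
    ... | yes _  | start | yes covers = inj₁ (covers , refl)
    ... | yes _  | start | no ¬covers = inj₂ (¬covers , refl)
    ... | yes _  | grow  | yes covers = inj₁ (covers , refl)
    ... | yes _  | grow  | no ¬covers = inj₂ (¬covers , refl)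
    ... | yes _  | stall | _          = ⊥-elim (¬stall refl)

    clusterRoot-γ : ∀ {u v} (p : Path u) (r : R M u γ v) → ¬ role p ≡ stall → clusterRoot (step p γ r) ≡ clusterRoot p
    clusterRoot-γ p r ¬stall with γ ≟ γ | role p
    ... | no γ≢γ | _     = ⊥-elim (γ≢γ refl)
    ... | yes _  | start = refl
    ... | yes _  | grow  = refl
    ... | yes _  | stall = ⊥-elim (¬stall refl)

    restart-other : ∀ {u v β} (p : Path u) (r : R M u β v) → ¬ β ≡ γ →
                    role (step p β r) ≡ start × clusterRoot (step p β r) ≡ (v , step p β r)
    restart-other {β = β} p r β≢γ with β ≟ γ
    ... | yes β≡γ = ⊥-elim (β≢γ β≡γ)
    ... | no _    = refl , refl

    restart-after-stall : ∀ {u v} (p : Path u) (r : R M u γ v) → role p ≡ stall →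
                          role (step p γ r) ≡ start × clusterRoot (step p γ r) ≡ (v , step p γ r)
    restart-after-stall p r e with γ ≟ γ | role p
    ... | no γ≢γ | _     = ⊥-elim (γ≢γ refl)
    ... | yes _  | stall = refl , refl

    data Member : Node → Node → Set where
      at-root : ∀ {u} (p : Path u) → role p ≡ start → Member (u , p) (u , p)
      below   : ∀ {r u v} {p : Path u} → Member r (u , p) → ¬ role p ≡ stall → (e : R M u γ v) → Member r (v , step p γ e)

    stall? : (ρ : Role) → Dec (ρ ≡ stall)
    stall? start = no λ ()
    stall? grow  = no λ ()
    stall? stall = yes refl

    view : ∀ {u} (q : Path u) → Member (clusterRoot q) (u , q)
    view root = at-root root refl
    view {v} (step {u} p β r) = go (β ≟ γ) r
      where
      fresh : ∀ {w} (q : Path w) → role q ≡ start × clusterRoot q ≡ (w , q) → Member (clusterRoot q) (w , q)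
      fresh q (role≡ , root≡) = subst (λ z → Member z _) (sym root≡) (at-root q role≡)
      go : ∀ {β} → Dec (β ≡ γ) → (e : R M u β v) → Member (clusterRoot (step p β e)) (v , step p β e)
      go (no β≢γ) e = fresh (step p _ e) (restart-other p e β≢γ)
      go (yes refl) e with stall? (role p)
      ... | yes stalled = fresh (step p γ e) (restart-after-stall p e stalled)
      ... | no ¬stalled = subst (λ z → Member z _) (sym (clusterRoot-γ p e ¬stalled)) (below (view p) ¬stalled e)

    Member⇒root : ∀ {r q} → Member r q → rootOf q ≡ r
    Member⇒root (at-root p e)              = clusterRoot-start p e
    Member⇒root (below {p = p} m ¬stall e) = trans (clusterRoot-γ p e ¬stall) (Member⇒root m)

    Member-height≥ : ∀ {r q} → Member r q → height r ≤ height q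
    Member-height≥ (at-root _ _)   = ≤-refl
    Member-height≥ (below m _ _) = m≤n⇒m≤1+n (Member-height≥ m)

    Safe : Node → Set
    Safe r = height r + size φ ≤ invDepth

    potential≤ : ∀ {r} → Safe r → height r + unboxed (proj₁ r) ≤ invDepth
    potential≤ {r} safe = ≤-trans (+-monoʳ-≤ (height r) (<⇒≤ (unboxed<size (proj₁ r)))) safe

    member-potential : ∀ {r u} {p : Path u} → Safe r → Member r (u , p) → ¬ role p ≡ stall →
                       depth p + unboxed u ≤ height r + unboxed (proj₁ r)
    member-potential safe (at-root _ _) _ = ≤-refl
    member-potential {r} safe (below {u = u} {v} {p} m ¬stall e) ¬stall′ with role-γ p e ¬stall
    ... | inj₁ (_ , stalled) = ⊥-elim (¬stall′ stalled)
    ... | inj₂ (¬covers , _) = begin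
      suc (depth p) + unboxed v   ≡⟨ sym (+-suc (depth p) (unboxed v)) ⟩
      depth p + suc (unboxed v)   ≤⟨ +-monoʳ-≤ (depth p) (unboxed-decreasing (inherits-child p within e) ¬covers) ⟩
      depth p + unboxed u         ≤⟨ potential ⟩
      height r + unboxed (proj₁ r) ∎
      where
      open ≤-Reasoning
      potential = member-potential safe m ¬stall
      within = ≤-trans (≤-trans (m≤m+n (depth p) (unboxed u)) potential) (potential≤ safe)

    Member-height≤ : ∀ {r q} → Safe r → Member r q → height q ≤ height r + size φ
    Member-height≤ safe (at-root _ _) = m≤m+n _ _
    Member-height≤ {r} safe (below {u = u} {p = p} m ¬stall e) =
      ≤-trans (s≤s (≤-trans (m≤m+n (depth p) (unboxed u)) (member-potential safe m ¬stall)))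
              (≤-trans (≤-reflexive (sym (+-suc (height r) (unboxed (proj₁ r))))) (+-monoʳ-≤ (height r) (unboxed<size (proj₁ r))))

    Member-within : ∀ {r q} → Safe r → Member r q → height q ≤ invDepth
    Member-within safe m = ≤-trans (Member-height≤ safe m) safe

    data Anchor (r : Node) : Node → Set where
      own        : ∀ {u} {p : Path u} → Member r (u , p) → ¬ role p ≡ stall → Anchor r (u , p)
      via-parent : ∀ {a u} {p : Path a} → Member r (a , p) → ¬ role p ≡ stall → (e : R M a γ u) → Covers a u →
                   Anchor r (u , step p γ e)

    anchor : ∀ {r q} → Member r q → Anchor r q
    anchor (at-root p e) = own (at-root p e) λ stalled → case trans (sym e) stalled of λ ()
    anchor (below {p = p} m ¬stall e) with role-γ p e ¬stall
    ... | inj₁ (covers , _) = via-parent m ¬stall e covers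
    ... | inj₂ (_ , grows)  = own (below m ¬stall e) λ stalled → case trans (sym grows) stalled of λ ()

    Witness : Node → W M → (W M → Set) → Set
    Witness r u P = Σ Node λ q → Member r q × P (proj₁ q) × Inherits u (proj₁ q) × (L₂ γ B ≡ true → Inherits (proj₁ q) u)

    member-child : ∀ {r a v} {p : Path a} → Safe r → Member r (a , p) → ¬ role p ≡ stall → (e : R M a γ v) →
                   Member r (v , step p γ e) × Inherits a v × (L₂ γ B ≡ true → Inherits v a)
    member-child {p = p} safe m ¬stall e =
      below m ¬stall e , inherits-child p (Member-within safe m) e ,
      λ eB → inherits-parent eB (step p γ e) (Member-within safe (below m ¬stall e)) e

    diamond-anchor : ∀ {r w θ} → Safe r → Anchor r w → ⟨ γ ⟩ θ ∈cl φ → M , proj₁ w ⊨ (⟨ γ ⟩ θ) →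
                     Witness r (proj₁ w) (λ v → M , v ⊨ θ)
    diamond-anchor {w = u , p} safe (own m ¬stall) θ∈ (v , e , hv) =
      let below-m , inh , inh⁻¹ = member-child safe m ¬stall e in (v , step p γ e) , below-m , hv , inh , inh⁻¹
    diamond-anchor {θ = θ} safe (via-parent {a} {u} {p} m ¬stall e covers) θ∈ h with a⊨◇θ
      where
      -- a and u carry the same boxes, so [γ]¬θ cannot hold at a
      a⊨◇θ : M , a ⊨ (⟨ γ ⟩ θ)
      a⊨◇θ = ⊨-stable (⟨ γ ⟩ θ) λ a⊭ →
        ⊨neg⇒⊭ M (⟨ γ ⟩ θ) (proj₂ (inherits-child p (Member-within safe m) e (∈cl-neg θ∈) (⊭⇒⊨neg (⟨ γ ⟩ θ) a⊭))) h
    ... | v , e′ , hv =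
      let below-m , inh , inh⁻¹ = member-child safe m ¬stall e′
      in (v , step p γ e′) , below-m , hv , covers-inherits covers inh ,
         λ eB → inherits-trans (inh⁻¹ eB) (inherits-child p (Member-within safe m) e)

    serial-anchor : ∀ {r w} → L₂ γ D ≡ true → Safe r → Anchor r w → Witness r (proj₁ w) (λ _ → ⊤)
    serial-anchor {w = u , p} eD safe (own m ¬stall) =
      let v , e = isL₂ γ D eD u ; below-m , inh , inh⁻¹ = member-child safe m ¬stall e
      in (v , step p γ e) , below-m , _ , inh , inh⁻¹
    serial-anchor eD safe (via-parent {a} {p = p} m ¬stall e covers) =
      let v , e′ = isL₂ γ D eD a ; below-m , inh , inh⁻¹ = member-child safe m ¬stall e′
      in (v , step p γ e′) , below-m , _ , covers-inherits covers inh ,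
         λ eB → inherits-trans (inh⁻¹ eB) (inherits-child p (Member-within safe m) e)

    _∼_ : Node → Node → Set
    w ∼ q = rootOf w ≡ rootOf q ×
            (Safe (rootOf w) → Inherits (proj₁ w) (proj₁ q) × (L₂ γ B ≡ true → Inherits (proj₁ q) (proj₁ w)))

    frame : ∀ c → L₁ γ c ≡ true → Satisfies _∼_ c
    frame D e (u , p) with em {Safe (clusterRoot p)}
    ... | no unsafe = (u , p) , refl , λ safe → ⊥-elim (unsafe safe)
    ... | yes safe with serial-anchor (L₁⇒L₂ refl e) safe (anchor (view p))
    ...   | q , m , _ , inh , inh⁻¹ = q , sym (Member⇒root m) , λ _ → inh , inh⁻¹
    frame T e (u , p) = refl , λ _ → inherits-refl (L₁⇒L₂ refl e) u , λ _ → inherits-refl (L₁⇒L₂ refl e) u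
    frame B e w q (same , f) = sym same , λ safe →
      let inh , inh⁻¹ = f (subst Safe (sym same) safe) in inh⁻¹ (L₁⇒L₂ refl e) , λ _ → inh
    frame C4 e w q s (same₁ , f₁) (same₂ , f₂) = trans same₁ same₂ , λ safe →
      let inh₁ , inh₁⁻¹ = f₁ safe ; inh₂ , inh₂⁻¹ = f₂ (subst Safe same₁ safe)
      in inherits-trans inh₁ inh₂ , λ eB → inherits-trans (inh₂⁻¹ eB) (inh₁⁻¹ eB)
    frame C5 e = ⊥-elim (5∉L₁ e)

    cluster-fits : ∀ {u} (p : Path u) → height (clusterRoot p) + size φ ≤ depth p + stride
    cluster-fits p = +-mono-≤ (Member-height≥ (view p)) (≤-reflexive (sym (stride≡size x∈45)))

    box-step : BoxStep γ _∼_
    box-step {u , p} {v , q} le (same , f) θ∈ h =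
      proj₁ (proj₁ (f safe) θ∈ h) ,
      ≤-trans (Member-height≤ safe (subst (λ z → Member z (v , q)) (sym same) (view q))) (cluster-fits p)
      where safe = ≤-trans (cluster-fits p) le

    diamond-step : DiamondStep γ _∼_
    diamond-step {u , p} le θ∈ h with diamond-anchor (≤-trans (cluster-fits p) le) (anchor (view p)) θ∈ h
    ... | q , m , hq , inh , inh⁻¹ =
      q , (sym (Member⇒root m) , λ _ → inh , inh⁻¹) , hq ,
      ≤-trans (Member-height≤ (≤-trans (cluster-fits p) le) m) (cluster-fits p)

    adequate : Adequate γ
    adequate = record { _∼_ = _∼_ ; frame = frame ; box-step = box-step ; diamond-step = diamond-step }

  not-in-L₁ : ∀ γ {c} → ¬ L₂ γ c ≡ true → (γ ∈ A → ¬ c ≡ x) → ¬ L₁ γ c ≡ true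
  not-in-L₁ γ {c} ∉L₂ ≢x e with L₁-split γ c e
  ... | inj₁ e₂          = ∉L₂ e₂
  ... | inj₂ (γ∈A , c≡x) = ≢x γ∈A c≡x

  not-in-L₂ : ∀ {γ} c → ¬ c ≺ x → ¬ L₂ γ c ≡ true
  not-in-L₂ {γ} c ¬≺ e = ¬≺ (L₂≺x γ c e)

  5-maximal : ∀ {c} → ¬ C5 ≺ c
  5-maximal {T}  (s≤s ())
  5-maximal {B}  (s≤s (s≤s ()))
  5-maximal {C4} (s≤s (s≤s (s≤s ())))
  5-maximal {C5} (s≤s (s≤s (s≤s (s≤s ()))))

  4-absent : ∀ γ → ¬ C4 ≺ x → (γ ∈ A → ¬ C4 ≡ x) → ¬ L₁ γ C4 ≡ true
  4-absent γ ¬≺ = not-in-L₁ γ (not-in-L₂ C4 ¬≺)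

  5-absent : ∀ γ → (γ ∈ A → ¬ C5 ≡ x) → ¬ L₁ γ C5 ≡ true
  5-absent γ = not-in-L₁ γ (not-in-L₂ C5 (5-maximal {x}))

  adequate-for : ∀ y → x ≡ y → ∀ γ → Adequate γ
  adequate-for D refl γ = Local.adequate γ (4-absent γ (λ ()) λ _ ()) (5-absent γ λ _ ())
  adequate-for T refl γ = Local.adequate γ (4-absent γ (λ { (s≤s ()) }) λ _ ()) (5-absent γ λ _ ())
  adequate-for B refl γ = Local.adequate γ (4-absent γ (λ { (s≤s (s≤s ())) }) λ _ ()) (5-absent γ λ _ ())
  adequate-for C4 refl γ with γ ∈? A
  ... | yes γ∈A = Transitive.adequate γ (x∈L₁ γ γ∈A) refl (5-absent γ λ _ ())
  ... | no γ∉A  = Local.adequate γ (4-absent γ (λ { (s≤s (s≤s (s≤s ()))) }) (⊥-elim ∘ γ∉A)) (5-absent γ (⊥-elim ∘ γ∉A))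
  adequate-for C5 refl γ with γ ∈? A
  ... | yes γ∈A = Euclidean.adequate γ refl γ∈A
  ... | no γ∉A with L₂ γ C4 in e4
  ...   | true  = Transitive.adequate γ (L₂⊆L₁ γ C4 e4) refl (5-absent γ (⊥-elim ∘ γ∉A))
  ...   | false = Local.adequate γ (not-in-L₁ γ (λ e → case trans (sym e4) e of λ ()) (⊥-elim ∘ γ∉A)) (5-absent γ (⊥-elim ∘ γ∉A))

  adequate : ∀ γ → Adequate γ
  adequate = adequate-for x refl

  R′ : Node → Fin n → Node → Set
  R′ w γ q = Adequate._∼_ (adequate γ) w q

  open BoundedTransfer M proj₁ R′ height stride invDepth φ
    (λ {γ} → Adequate.box-step (adequate γ)) (λ {γ} → Adequate.diamond-step (adequate γ))

  M′-is-L₁ : IsLModel L₁ M′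
  M′-is-L₁ γ c e = satisfies⇒holds M′ γ c (Adequate.frame (adequate γ) c e)

  satisfiable : M , w₀ ⊨ φ → Satisfiable L₁ φ
  satisfiable hφ = M′ , M′-is-L₁ , (w₀ , root) , transfer φ ∈cl-self (w₀ , root) (≤-reflexive stride*md≡invDepth) hφ

tr-satisfiable⇒satisfiable : ∀ {n m} → ExcludedMiddle 0ℓ → {A : Subset n} {x : Cond} {L₁ L₂ : Logic n} →
  (∀ α c → L₁ α c ≡ true → L₂ α c ≡ true ⊎ (α ∈ A × c ≡ x)) →
  (∀ α c → L₂ α c ≡ true → L₁ α c ≡ true) → (∀ α → α ∈ A → L₁ α x ≡ true) →
  (∀ α c → L₂ α c ≡ true → c ≺ x) →
  (φ : Form n m) → Satisfiable L₂ (tr x A φ) → Satisfiable L₁ φ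
tr-satisfiable⇒satisfiable em L₁-split L₂⊆L₁ x∈L₁ L₂≺x φ (M , isL₂ , w₀ , hφ , w₀⊨inv) =
  Backward.satisfiable em L₁-split L₂⊆L₁ x∈L₁ L₂≺x φ M isL₂ w₀ w₀⊨inv hφ

theorem3p6 : ExcludedMiddle 0ℓ →
    (n m : ℕ) (A : Subset n) (x : Cond) (L₁ L₂ : Logic n) →
    (∀ α → α ∈ A → ∀ c → (L₁ α c ≡ true) ⇔ (L₂ α c ≡ true ⊎ c ≡ x)) →
    (∀ α → α ∉ A → ∀ c → L₁ α c ≡ L₂ α c) →
    (∀ α c → L₂ α c ≡ true → c ≺ x) →
    (φ : Form n m) →
    Satisfiable L₁ φ ⇔ Satisfiable L₂ (tr x A φ)
theorem3p6 em n m A x L₁ L₂ hA h∉A L₂≺x φ =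
  mk⇔ (satisfiable⇒tr-satisfiable em (L₂⊆L₁ hA h∉A) (x∈L₁ hA h∉A) φ)
      (tr-satisfiable⇒satisfiable em (L₁-split hA h∉A) (L₂⊆L₁ hA h∉A) (x∈L₁ hA h∉A) L₂≺x φ)
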